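{- Let $u,x$ be nodes of an $\mathcal{L}$-network $N$ (not necessarily binary). Let $e$ be an edge incident to $u$ that forms a path from $u$ to its other endpoint $v$, i.e. $e$ is either undirected or directed from $u$ to $v$. Then $M(u,x;e)\sqcup M(v,x;e)$ is in bijection with $M(u,x)$. In particular, $m(u,x)=m(u,x;e)+m(v,x;e)$.
   Context: A semidirected graph has undirected edges and directed edges (parent to child), parallel edges allowed. A path is semidirected if its undirected edges can be oriented so that it becomes a directed path; all paths are semidirected. An $\mathcal{L}$-network is a semidirected graph with no semidirected cycle whose leaves (nodes with no outgoing directed edge and no undirected edge) have at most one incoming edge, with an injective labelling of leaves by $\mathcal{L}=[n]$. $M(u,x)$ is the set of semidirected paths from $u$ to $x$, $M(u,x;e)$ the subset of those not containing edge $e$, $m(u,x)=|M(u,x)|$ and $m(u,x;e)=|M(u,x;e)|$. -}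

module Defs where

open import Data.Nat using (ℕ; zero; suc; _+_)
open import Data.Fin using (Fin)
open import Data.List using (List; []; _∷_)
open import Data.List.Membership.Propositional using (_∈_; _∉_)
open import Data.List.Relation.Unary.Unique.Propositional using (Unique)
open import Data.Product using (_×_; Σ; _,_)
open import Data.Sum using (_⊎_)
open import Data.Empty using (⊥)
open import Relation.Binary.PropositionalEquality using (_≡_; _≢_)
open import Function using (Injective)

-- Kind of an edge: undirected, or directed from end₁ (parent) to end₂ (child).
data EdgeKind : Set where
  undir : EdgeKind
  dir   : EdgeKind

record SDGraph : Set where
  field
    V    : ℕ
    E    : ℕ
    kind : Fin E → EdgeKind
    end₁ : Fin E → Fin V
    end₂ : Fin E → Fin V

module _ (G : SDGraph) where
  open SDGraph G

  Node : Set
  Node = Fin V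

  Edge : Set
  Edge = Fin E

  Step : Edge → Node → Node → Set
  Step e a b = (end₁ e ≡ a × end₂ e ≡ b) ⊎ (kind e ≡ undir × end₁ e ≡ b × end₂ e ≡ a)

  data Walk : Node → Node → Set where
    []  : ∀ {a} → Walk a a
    _∷_ : ∀ {a b c} (e : Edge) → .(Step e a b) → Walk b c → Walk a c

  nodes : ∀ {a c} → Walk a c → List Node
  nodes {a} []            = a ∷ []
  nodes {a} (_∷_ e _ w)   = a ∷ nodes w

  targets : ∀ {a c} → Walk a c → List Node
  targets []          = []
  targets (_∷_ {b = b} e _ w) = b ∷ targets w

  edges : ∀ {a c} → Walk a c → List Edge
  edges []          = []
  edges (_∷_ e _ w) = e ∷ edges w

  NonEmpty : ∀ {a c} → Walk a c → Set
  NonEmpty w = Σ Edge (λ e → e ∈ edges w)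

  -- semidirected cycle: closed walk of positive length, distinct edges,
  -- distinct nodes (each node counted once)
  IsCycle : ∀ {a} → Walk a a → Set
  IsCycle w = NonEmpty w × Unique (targets w) × Unique (edges w)

  -- M(a,b): semidirected paths (walks with pairwise distinct nodes).
  -- Proof fields are irrelevant so paths are equal iff their walks are.
  record Path (a b : Node) : Set where
    constructor path
    field
      walk      : Walk a b
      .distinct : Unique (nodes walk)

  record PathAvoiding (a b : Node) (e : Edge) : Set where
    constructor pathAvoiding
    field
      walk      : Walk a b
      .distinct : Unique (nodes walk)
      .avoids   : e ∉ edges walk

  IsLeaf : Node → Set
  IsLeaf v = (∀ e → kind e ≡ dir → end₁ e ≢ v)
           × (∀ e → kind e ≡ undir → end₁ e ≢ v × end₂ e ≢ v)

  IncomingDir : Edge → Node → Set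
  IncomingDir e v = kind e ≡ dir × end₂ e ≡ v

-- An L-network with L = [n] = Fin n.
record Network (n : ℕ) : Set where
  field
    graph   : SDGraph
  open SDGraph graph
  field
    acyclic   : ∀ {a} (w : Walk graph a a) → IsCycle graph w → ⊥
    leafInDeg : ∀ v → IsLeaf graph v → ∀ e f →
                IncomingDir graph e v → IncomingDir graph f v → e ≡ f
    label     : Fin n → Fin V
    labelInj  : Injective _≡_ _≡_ label
    labelLeaf : ∀ i → IsLeaf graph (label i)
    leafLabel : ∀ v → IsLeaf graph v → Σ (Fin n) (λ i → label i ≡ v)

-- A path from u that uses e must begin with e: an occurrence of e further along would put u on
-- the path twice. Conversely, prepending e to a path from v that avoids e gives a path, because
-- if u were on it, e followed by its segment from v back to u would be a semidirected cycle.
module Submission where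

open import Defs
open import Data.Nat using (_+_)
open import Data.Fin using (Fin; _≟_)
open import Data.Fin.Properties using (+↔⊎)
open import Data.Fin.Permutation using (↔⇒≡)
open import Data.Sum using (_⊎_; inj₁; inj₂; [_,_])
open import Data.Sum.Function.Propositional using (_⊎-↔_)
open import Data.Product using (_×_; _,_; Σ; ∃)
open import Data.List using (List; []; _∷_; _++_)
open import Data.List.Membership.Propositional using (_∈_; _∉_)
open import Data.List.Membership.Propositional.Properties using (∈-++⁺ˡ)
import Data.List.Membership.DecPropositional as DecMembership
open import Data.List.Relation.Unary.Any using (here; there)
open import Data.List.Relation.Unary.All.Properties using (¬Any⇒All¬; ++⁻ˡ)
open import Data.List.Relation.Unary.AllPairs using ([]; _∷_; tail)
open import Data.List.Relation.Unary.Unique.Propositional using (Unique)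
open import Data.List.Relation.Unary.Unique.Propositional.Properties using (Unique[x∷xs]⇒x∉xs)
import Data.Empty.Irrelevant as Irrelevant
open import Function using (_∘_)
open import Function.Bundles using (_↔_; mk⤖)
open import Function.Definitions using (Injective; StrictlySurjective)
open import Function.Consequences.Propositional using (strictlySurjective⇒surjective)
open import Function.Properties.Bijection using (⤖⇒↔)
open import Function.Properties.Inverse using (↔-trans; ↔-sym)
open import Relation.Binary.PropositionalEquality using (_≡_; refl; sym; trans; cong; subst)
open import Relation.Nullary using (yes; no; recompute)

Unique-++⁻ˡ : ∀ {A : Set} (xs : List A) {ys} → Unique (xs ++ ys) → Unique xs
Unique-++⁻ˡ []       _         = []
Unique-++⁻ˡ (x ∷ xs) (px ∷ u) = ++⁻ˡ xs px ∷ Unique-++⁻ˡ xs u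

∉⇒Unique-∷ : ∀ {A : Set} {x : A} {xs} → x ∉ xs → Unique xs → Unique (x ∷ xs)
∉⇒Unique-∷ x∉xs u = ¬Any⇒All¬ _ x∉xs ∷ u

card-⊎ : ∀ {A B C : Set} {a b c} → (A ⊎ B) ↔ C → A ↔ Fin a → B ↔ Fin b → C ↔ Fin c → c ≡ a + b
card-⊎ A⊎B↔C A↔a B↔b C↔c =
  ↔⇒≡ (↔-trans (↔-sym C↔c) (↔-trans (↔-sym A⊎B↔C) (↔-trans (A↔a ⊎-↔ B↔b) (↔-sym +↔⊎))))

module _ {G : SDGraph} where
  open SDGraph G using (V)
  open DecMembership (_≟_ {V}) using (_∈?_)

  private variable
    a b c u v x : Node G
    e : Edge G

  Step-source : Step G e u v → Step G e a b → u ≡ a ⊎ u ≡ b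
  Step-source (inj₁ (refl , _))     (inj₁ (p , _))     = inj₁ p
  Step-source (inj₁ (refl , _))     (inj₂ (_ , p , _)) = inj₂ p
  Step-source (inj₂ (_ , _ , refl)) (inj₁ (_ , p))     = inj₂ p
  Step-source (inj₂ (_ , _ , refl)) (inj₂ (_ , _ , p)) = inj₁ p

  Step-deterministic : Step G e u v → Step G e u b → b ≡ v
  Step-deterministic (inj₁ (_ , refl))     (inj₁ (_ , p))        = sym p
  Step-deterministic (inj₁ (refl , refl))  (inj₂ (_ , refl , p)) = sym p
  Step-deterministic (inj₂ (_ , p , q))    (inj₁ (refl , refl))  = trans q p
  Step-deterministic (inj₂ (_ , refl , _)) (inj₂ (_ , p , _))    = sym p

  source∈nodes : (w : Walk G a c) → a ∈ nodes G w
  source∈nodes []          = here refl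
  source∈nodes (_∷_ _ _ _) = here refl

  nodes≡source∷targets : (w : Walk G a c) → nodes G w ≡ a ∷ targets G w
  nodes≡source∷targets []          = refl
  nodes≡source∷targets (_∷_ _ _ w) = cong (_ ∷_) (nodes≡source∷targets w)

  -- Steps are irrelevant, so membership is recomputed from its decision procedure.
  ∈edges⇒source∈nodes : .(Step G e u v) → (w : Walk G a c) → e ∈ edges G w → u ∈ nodes G w
  ∈edges⇒source∈nodes s (_∷_ _ st w) (here refl) = recompute (_ ∈? _) (source∈head (Step-source s st))
    where
    source∈head : u ≡ _ ⊎ u ≡ _ → u ∈ nodes G (_∷_ _ st w)
    source∈head (inj₁ refl) = here refl
    source∈head (inj₂ refl) = there (source∈nodes w)
  ∈edges⇒source∈nodes s (_∷_ _ _ w) (there e∈w) = there (∈edges⇒source∈nodes s w e∈w)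

  Unique-nodes⇒Unique-edges : (w : Walk G a c) → Unique (nodes G w) → Unique (edges G w)
  Unique-nodes⇒Unique-edges []           _          = []
  Unique-nodes⇒Unique-edges (_∷_ _ st w) d@(_ ∷ uw) =
    ∉⇒Unique-∷ (Unique[x∷xs]⇒x∉xs d ∘ ∈edges⇒source∈nodes st w) (Unique-nodes⇒Unique-edges w uw)

  split-at : (q : Walk G v x) → u ∈ nodes G q →
             Σ (Walk G v u) λ r → Σ (Walk G u x) λ t →
               (nodes G q ≡ nodes G r ++ targets G t) × (edges G q ≡ edges G r ++ edges G t)
  split-at []           (here refl) = [] , [] , refl , refl
  split-at (_∷_ e st q) (here refl) = [] , _∷_ e st q , cong (_ ∷_) (nodes≡source∷targets q) , refl
  split-at (_∷_ e st q) (there u∈q) with split-at q u∈q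
  ... | r , t , nodes≡ , edges≡ = _∷_ e st r , t , cong (_ ∷_) nodes≡ , cong (e ∷_) edges≡

  IsCycle-∷ : .(s : Step G e u v) (r : Walk G v u) → Unique (nodes G r) → e ∉ edges G r →
              IsCycle G (_∷_ e s r)
  IsCycle-∷ {e = e} s r ur e∉r =
    (e , here refl) , subst Unique (nodes≡source∷targets r) ur , ∉⇒Unique-∷ e∉r (Unique-nodes⇒Unique-edges r ur)

  ∈edges⇒starts-with : .(s : Step G e u v) (w : Walk G u x) → .(Unique (nodes G w)) → e ∈ edges G w →
                       ∃ λ q → w ≡ _∷_ e s q
  ∈edges⇒starts-with {v = v} s (_∷_ {b = b} _ st w) _ (here refl) with recompute (b ≟ v) (Step-deterministic s st)
  ... | refl = w , refl
  ∈edges⇒starts-with s (_∷_ _ _ w) d (there e∈w) =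
    Irrelevant.⊥-elim (Unique[x∷xs]⇒x∉xs d (∈edges⇒source∈nodes s w e∈w))

module _ {n} (N : Network n) where
  open Network N using (graph; acyclic)
  open SDGraph graph using (E)
  open DecMembership (_≟_ {E}) using (_∈?_)

  source∉avoiding-path : ∀ {u v x e} → Step graph e u v → (q : Walk graph v x) → Unique (nodes graph q) →
                         e ∉ edges graph q → u ∉ nodes graph q
  source∉avoiding-path {e = e} s q uq e∉q u∈q with split-at q u∈q
  ... | r , _ , nodes≡ , edges≡ =
    acyclic (_∷_ e s r) (IsCycle-∷ s r (Unique-++⁻ˡ (nodes graph r) (subst Unique nodes≡ uq))
                                       (e∉q ∘ subst (e ∈_) (sym edges≡) ∘ ∈-++⁺ˡ))

  module _ {u v : Node graph} {e : Edge graph} (s : Step graph e u v) {x : Node graph} where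
    fromAvoiding : PathAvoiding graph u x e ⊎ PathAvoiding graph v x e → Path graph u x
    fromAvoiding = [ (λ where (pathAvoiding w d _) → path w d)
              , (λ where (pathAvoiding q d e∉q) →
                           path (_∷_ e s q) (∉⇒Unique-∷ (source∉avoiding-path s q d e∉q) d)) ]

    fromAvoiding-injective : Injective _≡_ _≡_ fromAvoiding
    fromAvoiding-injective {inj₁ _}                      {inj₁ _}                      refl = refl
    fromAvoiding-injective {inj₂ _}                      {inj₂ _}                      refl = refl
    fromAvoiding-injective {inj₁ (pathAvoiding _ _ e∉w)} {inj₂ _}                      refl =
      Irrelevant.⊥-elim (e∉w (here refl))
    fromAvoiding-injective {inj₂ _}                      {inj₁ (pathAvoiding _ _ e∉w)} refl =
      Irrelevant.⊥-elim (e∉w (here refl))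

    fromAvoiding-strictlySurjective : StrictlySurjective _≡_ fromAvoiding
    fromAvoiding-strictlySurjective (path w d) with e ∈? edges graph w
    ... | no e∉w = inj₁ (pathAvoiding w d e∉w) , refl
    ... | yes e∈w with ∈edges⇒starts-with s w d e∈w
    ...   | q , refl =
      inj₂ (pathAvoiding q (tail d) (Unique[x∷xs]⇒x∉xs d ∘ ∈edges⇒source∈nodes s q)) , refl

    fromAvoiding-↔ : (PathAvoiding graph u x e ⊎ PathAvoiding graph v x e) ↔ Path graph u x
    fromAvoiding-↔ = ⤖⇒↔ (mk⤖ (fromAvoiding-injective , strictlySurjective⇒surjective fromAvoiding-strictlySurjective))

lemma1 : ∀ {n} (N : Network n) (u x v : Node (Network.graph N)) (e : Edge (Network.graph N)) →
         Step (Network.graph N) e u v →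
         ((PathAvoiding (Network.graph N) u x e ⊎ PathAvoiding (Network.graph N) v x e) ↔ Path (Network.graph N) u x)
         × (∀ a b c → (PathAvoiding (Network.graph N) u x e ↔ Fin a) → (PathAvoiding (Network.graph N) v x e ↔ Fin b) →
            (Path (Network.graph N) u x ↔ Fin c) → c ≡ a + b)
lemma1 N u x v e s = fromAvoiding-↔ N s , λ a b c → card-⊎ (fromAvoiding-↔ N s)
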